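{- Let $0<\delta<1/2$ and $x_1,\dots,x_n,y_1,\dots,y_n,z_1,\dots,z_n\in\{0,1\}$. Suppose $$(0.x_1\ldots x_n)_{1/2}+(0.y_1\ldots y_n)_{1/2}=(0.z_1\ldots z_n)_{1/2}$$ and $$(0.x_1\ldots x_n)_{1/2}\ge(0.y_1\ldots y_n)_{1/2}.$$ Then $$(0.x_1\ldots x_n)_\delta+\frac{\delta}{1-\delta}(0.y_1\ldots y_n)_\delta\ \ge\ (0.z_1\ldots z_n)_\delta.$$
   Context: For $0<\theta<1$ and bits $w_1,\dots,w_n\in\{0,1\}$, define $(0.w_1\ldots w_n)_\theta=\sum_{i=1}^n w_i(1-\theta)^i\big(\tfrac{\theta}{1-\theta}\big)^{s_w(i)}$, where $s_w(i)=\sum_{j=1}^{i-1}w_j$. For $\theta=1/2$ this is the ordinary binary expansion $\sum_i w_i2^{ -i}$.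
   Formalization: The parameter δ is taken rational, with $0<\delta<1/2$. -}

module Defs where

open import Data.Bool using (Bool; true; false)
open import Data.Nat as ℕ using (ℕ; zero; suc)
open import Data.Vec using (Vec; []; _∷_)
open import Data.Rational using (ℚ; 0ℚ; 1ℚ; _+_; _*_; _-_; 1/_; ≢-nonZero)
open import Data.Rational.Properties using (_≟_)
open import Relation.Nullary using (yes; no)

_^ℚ_ : ℚ → ℕ → ℚ
q ^ℚ zero  = 1ℚ
q ^ℚ suc k = q * (q ^ℚ k)

-- p / q, totalised (value 0 when q = 0); only ever used with q ≠ 0 below
_/ℚ_ : ℚ → ℚ → ℚ
p /ℚ q with q ≟ 0ℚ
... | yes _  = 0ℚ
... | no q≢0 = p * (1/_ q {{≢-nonZero q≢0}})

bitℚ : Bool → ℚ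
bitℚ true  = 1ℚ
bitℚ false = 0ℚ

bit : Bool → ℕ
bit true  = 1
bit false = 0

-- go θ i s (w_i … w_n) = Σ_{j ≥ i} w_j (1-θ)^j (θ/(1-θ))^{s_w(j)},
-- where s is the running value s_w(i) = w_1 + … + w_{i-1}.
expansionFrom : ℚ → ℕ → ℕ → ∀ {m} → Vec Bool m → ℚ
expansionFrom θ i s []           = 0ℚ
expansionFrom θ i s (w ∷ ws) =
  (bitℚ w * ((1ℚ - θ) ^ℚ i) * ((θ /ℚ (1ℚ - θ)) ^ℚ s))
  + expansionFrom θ (suc i) (s ℕ.+ bit w) ws

expansion : ℚ → ∀ {n} → Vec Bool n → ℚ
expansion θ w = expansionFrom θ 1 0 w

{-# OPTIONS --safe #-}

-- Write Hₜ(w) = (0.w)ₜ. Peeling off the leading digit gives Hₜ(0w) = (1-t)·Hₜ(w) and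
-- Hₜ(1w) = (1-t) + t·Hₜ(w): Hₜ(w) is the probability that a random digit sequence, each digit
-- being 1 with probability t, lies lexicographically below w.  For t = ½ this is the binary
-- value, so the hypotheses say that ripple-carry addition of x and y yields z with no final
-- carry, and that x ≥ y lexicographically.  Following the addition digit by digit, with c the
-- carry out, induction gives for 0 ≤ t ≤ ½
--     Hₜ(c z) ≤ (1-t)·Hₜ(x) + t·Hₜ(y)    (c z is the halved sum (x+y)/2),
-- where at the first digit in which x and y differ one needs the subadditivity
-- c + Hₜ(z) ≤ Hₜ(x) + Hₜ(y), a second induction that rests on the concavity of the digit maps
-- for t ≤ ½.  For c = 0 the left-hand side is (1-t)·Hₜ(z); dividing by 1-t gives the theorem.

module Submission where

open import Defs
open import Data.Bool using (Bool; true; false; not; T; _xor_; if_then_else_)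
open import Data.Nat using (ℕ; suc)
import Data.Nat.Properties as ℕ
open import Data.Vec using (Vec)
open import Data.Product using (_×_; _,_; proj₁; proj₂; ∃₂; map)
open import Data.List using (_∷_; [])
open import Relation.Nullary using (¬_; yes; no; contradiction)
open import Relation.Nullary.Decidable using (dec⇒maybe; from-yes)
open import Relation.Binary.PropositionalEquality
  using (_≡_; _≢_; refl; sym; ≢-sym; trans; cong; cong₂; subst; module ≡-Reasoning)
open import Data.Rational
  using ( ℚ; 0ℚ; 1ℚ; ½; _+_; _*_; _-_; -_; 1/_; _≤_; _<_; _≥_
        ; NonNegative; Positive; nonNegative; positive; ≢-nonZero)
open import Data.Rational.Properties
import Tactic.RingSolver.Core.AlmostCommutativeRing as ACR
open import Tactic.RingSolver using (solve-∀; solve)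

ℚ-ring : ACR.AlmostCommutativeRing _ _
ℚ-ring = ACR.fromCommutativeRing +-*-commutativeRing (λ p → dec⇒maybe (0ℚ ≟ p))

private
  variable
    m : ℕ
    s u v X Y Z : ℚ

0≤1 : 0ℚ ≤ 1ℚ
0≤1 = from-yes (0ℚ ≤? 1ℚ)

0<½ : 0ℚ < ½
0<½ = from-yes (0ℚ <? ½)

½<1 : ½ < 1ℚ
½<1 = from-yes (½ <? 1ℚ)

p≤q⇒0≤q-p : ∀ {p q} → p ≤ q → 0ℚ ≤ q - p
p≤q⇒0≤q-p {p} {q} p≤q = subst (_≤ q - p) (+-inverseʳ p) (+-monoˡ-≤ (- p) p≤q)

p<q⇒0<q-p : ∀ {p q} → p < q → 0ℚ < q - p
p<q⇒0<q-p {p} {q} p<q = subst (_< q - p) (+-inverseʳ p) (+-monoˡ-< (- p) p<q)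

<⇒≱ : ∀ {p q} → p < q → ¬ (q ≤ p)
<⇒≱ p<q q≤p = <-irrefl refl (<-≤-trans p<q q≤p)

≤-+-comm : u ≤ X + Y → u ≤ Y + X
≤-+-comm {u} {X} {Y} = subst (u ≤_) (+-comm X Y)

p/ℚq*q≡p : ∀ p {q} → q ≢ 0ℚ → (p /ℚ q) * q ≡ p
p/ℚq*q≡p p {q} q≢0 with q ≟ 0ℚ
... | yes q≡0 = contradiction q≡0 q≢0
... | no  _   = begin
  p * 1/q * q   ≡⟨ *-assoc p 1/q q ⟩
  p * (1/q * q) ≡⟨ cong (p *_) (*-inverseˡ q {{≢-nonZero q≢0}}) ⟩
  p * 1ℚ        ≡⟨ *-identityʳ p ⟩
  p             ∎
  where
  open ≡-Reasoning
  1/q = (1/ q) {{≢-nonZero q≢0}}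

≤-cancel-factor : ∀ {a b ρ} → 0ℚ < a → ρ * a ≡ b → a * Z ≤ a * X + b * Y → Z ≤ X + ρ * Y
≤-cancel-factor {Z} {X} {Y} {a} {b} {ρ} 0<a refl aZ≤ = *-cancelˡ-≤-pos a {{positive 0<a}} (begin
  a * Z             ≤⟨ aZ≤ ⟩
  a * X + ρ * a * Y ≡⟨ solve (a ∷ ρ ∷ X ∷ Y ∷ []) ℚ-ring ⟩
  a * (X + ρ * Y)   ∎)
  where open ≤-Reasoning

prepend : ℚ → Bool → ℚ → ℚ
prepend t false u = (1ℚ - t) * u
prepend t true  u = (1ℚ - t) + t * u

prepend-1≡prepend-0 : ∀ t → prepend t false 1ℚ ≡ prepend t true 0ℚ
prepend-1≡prepend-0 t = begin
  (1ℚ - t) * 1ℚ     ≡⟨ solve (t ∷ []) ℚ-ring ⟩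
  (1ℚ - t) + t * 0ℚ ∎
  where open ≡-Reasoning

prepend-affine : ∀ t b → prepend t b ((1ℚ - s) * X + s * Y) ≡ (1ℚ - s) * prepend t b X + s * prepend t b Y
prepend-affine {s} {X} {Y} t false = begin
  (1ℚ - t) * ((1ℚ - s) * X + s * Y)
    ≡⟨ solve (t ∷ s ∷ X ∷ Y ∷ []) ℚ-ring ⟩
  (1ℚ - s) * ((1ℚ - t) * X) + s * ((1ℚ - t) * Y)
    ∎
  where open ≡-Reasoning
prepend-affine {s} {X} {Y} t true = begin
  (1ℚ - t) + t * ((1ℚ - s) * X + s * Y)
    ≡⟨ solve (t ∷ s ∷ X ∷ Y ∷ []) ℚ-ring ⟩
  (1ℚ - s) * ((1ℚ - t) + t * X) + s * ((1ℚ - t) + t * Y)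
    ∎
  where open ≡-Reasoning

prepend-½ : ∀ b u → prepend ½ b u ≡ ½ * (bitℚ b + u)
prepend-½ false u = begin
  (1ℚ - ½) * u ≡⟨ solve (u ∷ []) ℚ-ring ⟩
  ½ * (0ℚ + u) ∎
  where open ≡-Reasoning
prepend-½ true u = begin
  (1ℚ - ½) + ½ * u ≡⟨ solve (u ∷ []) ℚ-ring ⟩
  ½ * (1ℚ + u)     ∎
  where open ≡-Reasoning

½-average-step : ∀ {a b c d k} → a + b + c ≡ d + k + k → X + Y ≡ c + Z →
                 ½ * (a + X) + ½ * (b + Y) ≡ k + ½ * (d + Z)
½-average-step {X} {Y} {Z} {a} {b} {c} {d} {k} digits tails = begin
  ½ * (a + X) + ½ * (b + Y) ≡⟨ solve (a ∷ b ∷ X ∷ Y ∷ []) ℚ-ring ⟩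
  ½ * (a + b + (X + Y))     ≡⟨ cong (λ w → ½ * (a + b + w)) tails ⟩
  ½ * (a + b + (c + Z))     ≡⟨ solve (a ∷ b ∷ c ∷ Z ∷ []) ℚ-ring ⟩
  ½ * ((a + b + c) + Z)     ≡⟨ cong (λ w → ½ * (w + Z)) digits ⟩
  ½ * ((d + k + k) + Z)     ≡⟨ solve (d ∷ k ∷ Z ∷ []) ℚ-ring ⟩
  k + ½ * (d + Z)           ∎
  where open ≡-Reasoning

module _ {t : ℚ} (0≤t : 0ℚ ≤ t) (t≤1 : t ≤ 1ℚ) where

  private instance
    t-nonNeg : NonNegative t
    t-nonNeg = nonNegative 0≤t
    1-t-nonNeg : NonNegative (1ℚ - t)
    1-t-nonNeg = nonNegative (p≤q⇒0≤q-p t≤1)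

  prepend-monoʳ-≤ : ∀ b → u ≤ v → prepend t b u ≤ prepend t b v
  prepend-monoʳ-≤ false u≤v = *-monoˡ-≤-nonNeg (1ℚ - t) u≤v
  prepend-monoʳ-≤ true  u≤v = +-monoʳ-≤ (1ℚ - t) (*-monoˡ-≤-nonNeg t u≤v)

  prepend-false≤prepend-true : u ≤ 1ℚ → 0ℚ ≤ v → prepend t false u ≤ prepend t true v
  prepend-false≤prepend-true {u} {v} u≤1 0≤v = begin
    prepend t false u  ≤⟨ prepend-monoʳ-≤ false u≤1 ⟩
    prepend t false 1ℚ ≡⟨ prepend-1≡prepend-0 t ⟩
    prepend t true 0ℚ  ≤⟨ prepend-monoʳ-≤ true 0≤v ⟩
    prepend t true v   ∎
    where open ≤-Reasoning

  0≤prepend-0 : ∀ b → 0ℚ ≤ prepend t b 0ℚ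
  0≤prepend-0 false = ≤-reflexive (sym (*-zeroʳ (1ℚ - t)))
  0≤prepend-0 true  = ≤-trans (0≤prepend-0 false) (prepend-false≤prepend-true 0≤1 ≤-refl)

  prepend-1≤1 : ∀ b → prepend t b 1ℚ ≤ 1ℚ
  prepend-1≤1 true  = ≤-reflexive (begin
    (1ℚ - t) + t * 1ℚ ≡⟨ solve (t ∷ []) ℚ-ring ⟩
    1ℚ                ∎)
    where open ≡-Reasoning
  prepend-1≤1 false = ≤-trans (prepend-false≤prepend-true ≤-refl 0≤1) (prepend-1≤1 true)

  midpoint-step-next : ∀ b → Z ≤ (1ℚ - t) * X + t * Y →
                       prepend t b Z ≤ (1ℚ - t) * prepend t b X + t * prepend t b Y
  midpoint-step-next {Z} {X} {Y} b Z≤ = begin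
    prepend t b Z                                ≤⟨ prepend-monoʳ-≤ b Z≤ ⟩
    prepend t b ((1ℚ - t) * X + t * Y)           ≡⟨ prepend-affine {t} {X} {Y} t b ⟩
    (1ℚ - t) * prepend t b X + t * prepend t b Y ∎
    where open ≤-Reasoning

  midpoint-step-this : ∀ c → bitℚ c + Z ≤ X + Y →
                       prepend t c (prepend t (not c) Z) ≤ (1ℚ - t) * prepend t true X + t * prepend t false Y
  midpoint-step-this {Z} {X} {Y} c c+Z≤ = begin
    prepend t c (prepend t (not c) Z)
      ≡⟨ prepend-prepend-not c ⟩
    (1ℚ - t) * ((1ℚ - t) + t * (bitℚ c + Z))
      ≤⟨ *-monoˡ-≤-nonNeg (1ℚ - t) (+-monoʳ-≤ (1ℚ - t) (*-monoˡ-≤-nonNeg t c+Z≤)) ⟩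
    (1ℚ - t) * ((1ℚ - t) + t * (X + Y))
      ≡⟨ solve (t ∷ X ∷ Y ∷ []) ℚ-ring ⟩
    (1ℚ - t) * ((1ℚ - t) + t * X) + t * ((1ℚ - t) * Y)
      ∎
    where
    open ≤-Reasoning
    prepend-prepend-not : ∀ c →
                          prepend t c (prepend t (not c) Z) ≡ (1ℚ - t) * ((1ℚ - t) + t * (bitℚ c + Z))
    prepend-prepend-not false = begin-equality
      (1ℚ - t) * ((1ℚ - t) + t * Z)        ≡⟨ solve (t ∷ Z ∷ []) ℚ-ring ⟩
      (1ℚ - t) * ((1ℚ - t) + t * (0ℚ + Z)) ∎
    prepend-prepend-not true  = begin-equality
      (1ℚ - t) + t * ((1ℚ - t) * Z)        ≡⟨ solve (t ∷ Z ∷ []) ℚ-ring ⟩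
      (1ℚ - t) * ((1ℚ - t) + t * (1ℚ + Z)) ∎

module _ {t : ℚ} (0<t : 0ℚ < t) (t<1 : t < 1ℚ) where

  private instance
    t-pos : Positive t
    t-pos = positive 0<t
    1-t-pos : Positive (1ℚ - t)
    1-t-pos = positive (p<q⇒0<q-p t<1)

  prepend-monoʳ-< : ∀ b → u < v → prepend t b u < prepend t b v
  prepend-monoʳ-< false u<v = *-monoʳ-<-pos (1ℚ - t) u<v
  prepend-monoʳ-< true  u<v = +-monoʳ-< (1ℚ - t) (*-monoʳ-<-pos t u<v)

  prepend-cancelʳ-≤ : ∀ b → prepend t b u ≤ prepend t b v → u ≤ v
  prepend-cancelʳ-≤ b bu≤bv = ≮⇒≥ (λ v<u → <⇒≱ (prepend-monoʳ-< b v<u) bu≤bv)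

  prepend-false<prepend-true : u < 1ℚ → 0ℚ ≤ v → prepend t false u < prepend t true v
  prepend-false<prepend-true {u} {v} u<1 0≤v = begin-strict
    prepend t false u  <⟨ prepend-monoʳ-< false u<1 ⟩
    prepend t false 1ℚ ≡⟨ prepend-1≡prepend-0 t ⟩
    prepend t true 0ℚ  ≤⟨ prepend-monoʳ-≤ (<⇒≤ 0<t) (<⇒≤ t<1) true 0≤v ⟩
    prepend t true v   ∎
    where open ≤-Reasoning

module _ {t : ℚ} (0≤t : 0ℚ ≤ t) (t≤½ : t ≤ ½) where

  private
    ½≤1-t : ½ ≤ 1ℚ - t
    ½≤1-t = +-monoʳ-≤ 1ℚ (neg-antimono-≤ t≤½)

    t≤1-t : t ≤ 1ℚ - t
    t≤1-t = ≤-trans t≤½ ½≤1-t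

    instance
      t-nonNeg : NonNegative t
      t-nonNeg = nonNegative 0≤t
      1-t-nonNeg : NonNegative (1ℚ - t)
      1-t-nonNeg = nonNegative (≤-trans (<⇒≤ 0<½) ½≤1-t)
      1-2t-nonNeg : NonNegative ((1ℚ - t) - t)
      1-2t-nonNeg = nonNegative (p≤q⇒0≤q-p t≤1-t)

  -- As a function of c + Z ∈ [0, 2], prepend t c Z is piecewise linear with slope 1-t on [0, 1]
  -- and slope t on [1, 2], hence concave for t ≤ ½ and bounded by both linear pieces (ˡ and ʳ).
  prepend≤ˡ : ∀ c → 0ℚ ≤ Z → prepend t c Z ≤ (1ℚ - t) * (bitℚ c + Z)
  prepend≤ˡ {Z} false _   = ≤-reflexive (cong ((1ℚ - t) *_) (sym (+-identityˡ Z)))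
  prepend≤ˡ {Z} true  0≤Z = begin
    (1ℚ - t) + t * Z        ≤⟨ +-monoʳ-≤ (1ℚ - t) (*-monoʳ-≤-nonNeg Z {{nonNegative 0≤Z}} t≤1-t) ⟩
    (1ℚ - t) + (1ℚ - t) * Z ≡⟨ solve (t ∷ Z ∷ []) ℚ-ring ⟩
    (1ℚ - t) * (1ℚ + Z)     ∎
    where open ≤-Reasoning

  prepend≤ʳ : ∀ c → Z ≤ 1ℚ → prepend t c Z ≤ ((1ℚ - t) - t) + t * (bitℚ c + Z)
  prepend≤ʳ {Z} false Z≤1 = begin
    (1ℚ - t) * Z                  ≡⟨ solve (t ∷ Z ∷ []) ℚ-ring ⟩
    ((1ℚ - t) - t) * Z + t * Z    ≤⟨ +-monoˡ-≤ (t * Z) (*-monoˡ-≤-nonNeg ((1ℚ - t) - t) Z≤1) ⟩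
    ((1ℚ - t) - t) * 1ℚ + t * Z   ≡⟨ solve (t ∷ Z ∷ []) ℚ-ring ⟩
    ((1ℚ - t) - t) + t * (0ℚ + Z) ∎
    where open ≤-Reasoning
  prepend≤ʳ {Z} true _ = ≤-reflexive (begin
    (1ℚ - t) + t * Z              ≡⟨ solve (t ∷ Z ∷ []) ℚ-ring ⟩
    ((1ℚ - t) - t) + t * (1ℚ + Z) ∎)
    where open ≡-Reasoning

  subadditive-step-00 : ∀ c → 0ℚ ≤ Z → bitℚ c + Z ≤ X + Y →
                        0ℚ + prepend t c Z ≤ prepend t false X + prepend t false Y
  subadditive-step-00 {Z} {X} {Y} c 0≤Z c+Z≤ = begin
    0ℚ + prepend t c Z          ≡⟨ +-identityˡ (prepend t c Z) ⟩
    prepend t c Z               ≤⟨ prepend≤ˡ c 0≤Z ⟩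
    (1ℚ - t) * (bitℚ c + Z)     ≤⟨ *-monoˡ-≤-nonNeg (1ℚ - t) c+Z≤ ⟩
    (1ℚ - t) * (X + Y)          ≡⟨ *-distribˡ-+ (1ℚ - t) X Y ⟩
    (1ℚ - t) * X + (1ℚ - t) * Y ∎
    where open ≤-Reasoning

  subadditive-step-11 : ∀ c → Z ≤ 1ℚ → bitℚ c + Z ≤ X + Y →
                        1ℚ + prepend t c Z ≤ prepend t true X + prepend t true Y
  subadditive-step-11 {Z} {X} {Y} c Z≤1 c+Z≤ = begin
    1ℚ + prepend t c Z
      ≤⟨ +-monoʳ-≤ 1ℚ (prepend≤ʳ c Z≤1) ⟩
    1ℚ + (((1ℚ - t) - t) + t * (bitℚ c + Z))
      ≤⟨ +-monoʳ-≤ 1ℚ (+-monoʳ-≤ ((1ℚ - t) - t) (*-monoˡ-≤-nonNeg t c+Z≤)) ⟩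
    1ℚ + (((1ℚ - t) - t) + t * (X + Y))
      ≡⟨ solve (t ∷ X ∷ Y ∷ []) ℚ-ring ⟩
    ((1ℚ - t) + t * X) + ((1ℚ - t) + t * Y)
      ∎
    where open ≤-Reasoning

  subadditive-step-10-carry₀ : 0ℚ ≤ Y → 0ℚ + Z ≤ X + Y →
                               0ℚ + prepend t true Z ≤ prepend t true X + prepend t false Y
  subadditive-step-10-carry₀ {Y} {Z} {X} 0≤Y Z≤ = begin
    0ℚ + ((1ℚ - t) + t * Z)
      ≡⟨ solve (t ∷ Z ∷ []) ℚ-ring ⟩
    (1ℚ - t) + t * (0ℚ + Z)
      ≤⟨ +-monoʳ-≤ (1ℚ - t) (*-monoˡ-≤-nonNeg t Z≤) ⟩
    (1ℚ - t) + t * (X + Y)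
      ≡⟨ solve (t ∷ X ∷ Y ∷ []) ℚ-ring ⟩
    ((1ℚ - t) + t * X) + t * Y
      ≤⟨ +-monoʳ-≤ ((1ℚ - t) + t * X) (*-monoʳ-≤-nonNeg Y {{nonNegative 0≤Y}} t≤1-t) ⟩
    ((1ℚ - t) + t * X) + (1ℚ - t) * Y
      ∎
    where open ≤-Reasoning

  subadditive-step-10-carry₁ : Z ≤ Y → 1ℚ + Z ≤ X + Y →
                               1ℚ + prepend t false Z ≤ prepend t true X + prepend t false Y
  subadditive-step-10-carry₁ {Z} {Y} {X} Z≤Y 1+Z≤ = begin
    1ℚ + (1ℚ - t) * Z
      ≡⟨ solve (t ∷ Z ∷ []) ℚ-ring ⟩
    (1ℚ - t) + (t * (1ℚ + Z) + ((1ℚ - t) - t) * Z)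
      ≤⟨ +-monoʳ-≤ (1ℚ - t) (+-mono-≤ (*-monoˡ-≤-nonNeg t 1+Z≤)
                                       (*-monoˡ-≤-nonNeg ((1ℚ - t) - t) Z≤Y)) ⟩
    (1ℚ - t) + (t * (X + Y) + ((1ℚ - t) - t) * Y)
      ≡⟨ solve (t ∷ X ∷ Y ∷ []) ℚ-ring ⟩
    ((1ℚ - t) + t * X) + (1ℚ - t) * Y
      ∎
    where open ≤-Reasoning

  subadditive-step-01-carry₀ : 0ℚ ≤ X → 0ℚ + Z ≤ X + Y →
                               0ℚ + prepend t true Z ≤ prepend t false X + prepend t true Y
  subadditive-step-01-carry₀ {X} {Z} {Y} 0≤X Z≤ = ≤-+-comm {X = prepend t true Y}
    (subadditive-step-10-carry₀ {Y = X} {X = Y} 0≤X (≤-+-comm {X = X} Z≤))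

  subadditive-step-01-carry₁ : Z ≤ X → 1ℚ + Z ≤ X + Y →
                               1ℚ + prepend t false Z ≤ prepend t false X + prepend t true Y
  subadditive-step-01-carry₁ {Z} {X} {Y} Z≤X 1+Z≤ = ≤-+-comm {X = prepend t true Y}
    (subadditive-step-10-carry₁ {Y = X} {X = Y} Z≤X (≤-+-comm {X = X} 1+Z≤))

-- Opened only here: in the ring solver's variable lists above, _∷_ must be the List constructor.
open import Data.Vec using ([]; _∷_)

private
  variable
    x y z : Vec Bool m

horner : ℚ → Vec Bool m → ℚ
horner t []      = 0ℚ
horner t (b ∷ w) = prepend t b (horner t w)

module _ {θ : ℚ} (1-θ≢0 : 1ℚ - θ ≢ 0ℚ) where

  private
    ρ : ℚ
    ρ = θ /ℚ (1ℚ - θ)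

  expansionFrom≡horner : ∀ i s (w : Vec Bool m) →
                         expansionFrom θ (suc i) s w ≡ (1ℚ - θ) ^ℚ i * ρ ^ℚ s * horner θ w
  expansionFrom≡horner i s [] = sym (*-zeroʳ ((1ℚ - θ) ^ℚ i * ρ ^ℚ s))
  expansionFrom≡horner i s (false ∷ w)
    rewrite ℕ.+-identityʳ s | expansionFrom≡horner (suc i) s w =
      digit-0 (1ℚ - θ) ((1ℚ - θ) ^ℚ i) (ρ ^ℚ s) (horner θ w)
    where
    digit-0 : ∀ q Q R H → 0ℚ * (q * Q) * R + q * Q * R * H ≡ Q * R * (q * H)
    digit-0 = solve-∀ ℚ-ring
  expansionFrom≡horner i s (true ∷ w)
    rewrite ℕ.+-comm s 1 | expansionFrom≡horner (suc i) (suc s) w =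
      trans (digit-1 (1ℚ - θ) ((1ℚ - θ) ^ℚ i) (ρ ^ℚ s) ρ (horner θ w))
            (cong (λ r → (1ℚ - θ) ^ℚ i * ρ ^ℚ s * ((1ℚ - θ) + r * horner θ w))
                  (p/ℚq*q≡p θ 1-θ≢0))
    where
    digit-1 : ∀ q Q R r H → 1ℚ * (q * Q) * R + q * Q * (r * R) * H ≡ Q * R * (q + r * q * H)
    digit-1 = solve-∀ ℚ-ring

  expansion≡horner : (w : Vec Bool m) → expansion θ w ≡ horner θ w
  expansion≡horner w = trans (expansionFrom≡horner 0 0 w) (*-identityˡ (horner θ w))

sum-bit : Bool → Bool → Bool → Bool
sum-bit a b c = (a xor b) xor c

carry : Bool → Bool → Bool → Bool
carry a b c = if a xor b then c else a

full-adder : ∀ a b c →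
             bitℚ a + bitℚ b + bitℚ c ≡ bitℚ (sum-bit a b c) + bitℚ (carry a b c) + bitℚ (carry a b c)
full-adder false false false = refl
full-adder false false true  = refl
full-adder false true  false = refl
full-adder false true  true  = refl
full-adder true  false false = refl
full-adder true  false true  = refl
full-adder true  true  false = refl
full-adder true  true  true  = refl

-- Digits are most significant first, so the carry runs from the tail to the head;
-- the Bool index is the carry out of the leading digit.
data Add : Vec Bool m → Vec Bool m → Vec Bool m → Bool → Set where
  []   : Add [] [] [] false
  cons : ∀ a b c → Add x y z c → Add (a ∷ x) (b ∷ y) (sum-bit a b c ∷ z) (carry a b c)

add : (x y : Vec Bool m) → ∃₂ λ z c → Add x y z c
add []      []      = [] , false , []
add (a ∷ x) (b ∷ y) with add x y
... | z , c , x+y = _ , _ , cons a b c x+y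

infix 4 _≥lex_

data _≥lex_ : Vec Bool m → Vec Bool m → Set where
  []   : [] ≥lex []
  next : ∀ {b} → x ≥lex y → (b ∷ x) ≥lex (b ∷ y)
  this : (true ∷ x) ≥lex (false ∷ y)

≥lex-antisym : x ≥lex y → y ≥lex x → x ≡ y
≥lex-antisym []       []       = refl
≥lex-antisym (next p) (next q) = cong (_ ∷_) (≥lex-antisym p q)

Add-carry⇒≥lex : ∀ {c} → Add x y z c → T c → x ≥lex z × y ≥lex z
Add-carry⇒≥lex (cons true  true  false x+y) _ = this , this
Add-carry⇒≥lex (cons true  true  true  x+y) _ = map next next (Add-carry⇒≥lex x+y _)
Add-carry⇒≥lex (cons true  false true  x+y) _ = this , next (proj₂ (Add-carry⇒≥lex x+y _))
Add-carry⇒≥lex (cons false true  true  x+y) _ = next (proj₁ (Add-carry⇒≥lex x+y _)) , this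
Add-carry⇒≥lex (cons false false _     _)   ()
Add-carry⇒≥lex (cons true  false false _)   ()
Add-carry⇒≥lex (cons false true  false _)   ()

module _ {t : ℚ} (0≤t : 0ℚ ≤ t) (t≤1 : t ≤ 1ℚ) where

  horner-nonNeg : (w : Vec Bool m) → 0ℚ ≤ horner t w
  horner-nonNeg []      = ≤-refl
  horner-nonNeg (b ∷ w) =
    ≤-trans (0≤prepend-0 0≤t t≤1 b) (prepend-monoʳ-≤ 0≤t t≤1 b (horner-nonNeg w))

  horner≤1 : (w : Vec Bool m) → horner t w ≤ 1ℚ
  horner≤1 []      = 0≤1
  horner≤1 (b ∷ w) =
    ≤-trans (prepend-monoʳ-≤ 0≤t t≤1 b (horner≤1 w)) (prepend-1≤1 0≤t t≤1 b)

  horner-mono-≥lex : x ≥lex y → horner t y ≤ horner t x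
  horner-mono-≥lex []               = ≤-refl
  horner-mono-≥lex (next {b = b} p) = prepend-monoʳ-≤ 0≤t t≤1 b (horner-mono-≥lex p)
  horner-mono-≥lex (this {x = x} {y = y}) =
    prepend-false≤prepend-true 0≤t t≤1 (horner≤1 y) (horner-nonNeg x)

module _ {t : ℚ} (0<t : 0ℚ < t) (t<1 : t < 1ℚ) where

  private
    0≤t : 0ℚ ≤ t
    0≤t = <⇒≤ 0<t
    t≤1 : t ≤ 1ℚ
    t≤1 = <⇒≤ t<1

  horner<1 : (w : Vec Bool m) → horner t w < 1ℚ
  horner<1 []      = positive⁻¹ 1ℚ
  horner<1 (b ∷ w) =
    <-≤-trans (prepend-monoʳ-< 0<t t<1 b (horner<1 w)) (prepend-1≤1 0≤t t≤1 b)

  horner-≤⇒≥lex : (x y : Vec Bool m) → horner t y ≤ horner t x → x ≥lex y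
  horner-≤⇒≥lex []          []          _ = []
  horner-≤⇒≥lex (true ∷ x)  (false ∷ y) _ = this
  horner-≤⇒≥lex (false ∷ x) (false ∷ y) h =
    next (horner-≤⇒≥lex x y (prepend-cancelʳ-≤ 0<t t<1 false h))
  horner-≤⇒≥lex (true ∷ x)  (true ∷ y)  h =
    next (horner-≤⇒≥lex x y (prepend-cancelʳ-≤ 0<t t<1 true h))
  horner-≤⇒≥lex (false ∷ x) (true ∷ y)  h = contradiction h
    (<⇒≱ (prepend-false<prepend-true 0<t t<1 (horner<1 x) (horner-nonNeg 0≤t t≤1 y)))

  horner-injective : (x y : Vec Bool m) → horner t x ≡ horner t y → x ≡ y
  horner-injective x y hx≡hy = ≥lex-antisym
    (horner-≤⇒≥lex x y (≤-reflexive (sym hx≡hy)))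
    (horner-≤⇒≥lex y x (≤-reflexive hx≡hy))

horner-½-Add : ∀ {c} → Add x y z c → horner ½ x + horner ½ y ≡ bitℚ c + horner ½ z
horner-½-Add []                               = refl
horner-½-Add (cons {x = x} {y} {z} a b c x+y) = begin
  prepend ½ a (horner ½ x) + prepend ½ b (horner ½ y)
    ≡⟨ cong₂ _+_ (prepend-½ a (horner ½ x)) (prepend-½ b (horner ½ y)) ⟩
  ½ * (bitℚ a + horner ½ x) + ½ * (bitℚ b + horner ½ y)
    ≡⟨ ½-average-step {horner ½ x} {horner ½ y} {horner ½ z} {bitℚ a} {bitℚ b} {bitℚ c}
                      {bitℚ (sum-bit a b c)} {bitℚ (carry a b c)} (full-adder a b c) (horner-½-Add x+y) ⟩
  bitℚ (carry a b c) + ½ * (bitℚ (sum-bit a b c) + horner ½ z)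
    ≡⟨ cong (bitℚ (carry a b c) +_) (sym (prepend-½ (sum-bit a b c) (horner ½ z))) ⟩
  bitℚ (carry a b c) + prepend ½ (sum-bit a b c) (horner ½ z)
    ∎
  where open ≡-Reasoning

horner-½-sum⇒Add : (x y z : Vec Bool m) → horner ½ x + horner ½ y ≡ horner ½ z → Add x y z false
horner-½-sum⇒Add x y z sum≡z with add x y
... | z′ , false , x+y = subst (λ w → Add x y w false) (horner-injective 0<½ ½<1 z′ z z′≡z) x+y
  where
  z′≡z : horner ½ z′ ≡ horner ½ z
  z′≡z = trans (sym (+-identityˡ (horner ½ z′))) (trans (sym (horner-½-Add x+y)) sum≡z)
... | z′ , true , x+y = contradiction 1≤z (<⇒≱ (horner<1 0<½ ½<1 z))
  where
  1≤z : 1ℚ ≤ horner ½ z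
  1≤z = ≤-trans (+-monoʳ-≤ 1ℚ (horner-nonNeg (<⇒≤ 0<½) (<⇒≤ ½<1) z′))
                (≤-reflexive (trans (sym (horner-½-Add x+y)) sum≡z))

module _ {t : ℚ} (0≤t : 0ℚ ≤ t) (t≤½ : t ≤ ½) where

  private
    t≤1 : t ≤ 1ℚ
    t≤1 = ≤-trans t≤½ (<⇒≤ ½<1)

  horner-subadditive : ∀ {c} → Add x y z c → bitℚ c + horner t z ≤ horner t x + horner t y
  horner-subadditive [] = ≤-refl
  horner-subadditive (cons {z = z} false false c x+y) =
    subadditive-step-00 0≤t t≤½ c (horner-nonNeg 0≤t t≤1 z) (horner-subadditive x+y)
  horner-subadditive (cons {z = z} true true c x+y) =
    subadditive-step-11 0≤t t≤½ c (horner≤1 0≤t t≤1 z) (horner-subadditive x+y)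
  horner-subadditive (cons {y = y} true false false x+y) =
    subadditive-step-10-carry₀ 0≤t t≤½ (horner-nonNeg 0≤t t≤1 y) (horner-subadditive x+y)
  horner-subadditive (cons true false true x+y) =
    subadditive-step-10-carry₁ 0≤t t≤½ (horner-mono-≥lex 0≤t t≤1 (proj₂ (Add-carry⇒≥lex x+y _)))
                               (horner-subadditive x+y)
  horner-subadditive (cons {x = x} false true false x+y) =
    subadditive-step-01-carry₀ 0≤t t≤½ (horner-nonNeg 0≤t t≤1 x) (horner-subadditive x+y)
  horner-subadditive (cons false true true x+y) =
    subadditive-step-01-carry₁ 0≤t t≤½ (horner-mono-≥lex 0≤t t≤1 (proj₁ (Add-carry⇒≥lex x+y _)))
                               (horner-subadditive x+y)

  horner-midpoint : ∀ {c} → Add x y z c → x ≥lex y →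
                    prepend t c (horner t z) ≤ (1ℚ - t) * horner t x + t * horner t y
  horner-midpoint [] [] = ≤-reflexive (zero-case t)
    where
    zero-case : ∀ t → (1ℚ - t) * 0ℚ ≡ (1ℚ - t) * 0ℚ + t * 0ℚ
    zero-case = solve-∀ ℚ-ring
  horner-midpoint (cons false false c x+y) (next x≥y) =
    midpoint-step-next 0≤t t≤1 false (horner-midpoint x+y x≥y)
  horner-midpoint (cons true true c x+y) (next x≥y) =
    midpoint-step-next 0≤t t≤1 true (horner-midpoint x+y x≥y)
  horner-midpoint (cons true false c x+y) this =
    midpoint-step-this 0≤t t≤1 c (horner-subadditive x+y)

  horner-sum-bound : Add x y z false → x ≥lex y →
                     horner t z ≤ horner t x + (t /ℚ (1ℚ - t)) * horner t y
  horner-sum-bound x+y x≥y =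
    ≤-cancel-factor {ρ = t /ℚ (1ℚ - t)} 0<1-t (p/ℚq*q≡p t (≢-sym (<⇒≢ 0<1-t)))
                    (horner-midpoint x+y x≥y)
    where
    0<1-t : 0ℚ < 1ℚ - t
    0<1-t = p<q⇒0<q-p (≤-<-trans t≤½ ½<1)

lemma4 : (δ : ℚ) → 0ℚ < δ → δ < ½ →
         (n : ℕ) → (x y z : Vec Bool n) →
         expansion ½ x + expansion ½ y ≡ expansion ½ z →
         expansion ½ x ≥ expansion ½ y →
         expansion δ x + (δ /ℚ (1ℚ - δ)) * expansion δ y ≥ expansion δ z
lemma4 δ 0<δ δ<½ n x y z sum½ x≥y½ = begin
  expansion δ z
    ≡⟨ eδ z ⟩
  horner δ z
    ≤⟨ horner-sum-bound (<⇒≤ 0<δ) (<⇒≤ δ<½) x+y x≥y ⟩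
  horner δ x + (δ /ℚ (1ℚ - δ)) * horner δ y
    ≡⟨ cong₂ (λ X Y → X + (δ /ℚ (1ℚ - δ)) * Y) (eδ x) (eδ y) ⟨
  expansion δ x + (δ /ℚ (1ℚ - δ)) * expansion δ y
    ∎
  where
  open ≤-Reasoning
  e½ : (w : Vec Bool n) → expansion ½ w ≡ horner ½ w
  e½ = expansion≡horner λ ()
  eδ : (w : Vec Bool n) → expansion δ w ≡ horner δ w
  eδ = expansion≡horner (≢-sym (<⇒≢ (p<q⇒0<q-p (<-trans δ<½ ½<1))))
  x+y : Add x y z false
  x+y = horner-½-sum⇒Add x y z (begin-equality
    horner ½ x + horner ½ y       ≡⟨ cong₂ _+_ (e½ x) (e½ y) ⟨
    expansion ½ x + expansion ½ y ≡⟨ sum½ ⟩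
    expansion ½ z                 ≡⟨ e½ z ⟩
    horner ½ z                    ∎)
  x≥y : x ≥lex y
  x≥y = horner-≤⇒≥lex 0<½ ½<1 x y (begin
    horner ½ y    ≡⟨ e½ y ⟨
    expansion ½ y ≤⟨ x≥y½ ⟩
    expansion ½ x ≡⟨ e½ x ⟩
    horner ½ x    ∎)
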